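{- Let $S$ and $T$ be finite sets of points on the real line with demands, and let $M$ be a minimum-cost OMMD between $S$ and $T$. Let $a,c\in S$ and $b,d\in T$ with $a\le b<c\le d$. If $(a,d)\in M$, then $(a,b)\in M$ or $(c,d)\in M$ (or both).
   Context: Each point $p\in S\cup T$ has a demand $\mathrm{demand}(p)\in\mathbb{Z}_{\ge1}$. An OMMD between $S$ and $T$ is a set $M\subseteq S\times T$ of pairs (each pair at most once) such that every point $p\in S$ is matched to at least $\mathrm{demand}(p)$ distinct points of $T$ and every point $p\in T$ is matched to at least $\mathrm{demand}(p)$ distinct points of $S$. Its cost is $\sum_{(s,t)\in M}|s-t|$; a minimum-cost OMMD is one of smallest cost. -}

module Defs where

open import Data.Nat using (ℕ; zero; suc) renaming (_+_ to _+ℕ_; _≤_ to _≤ℕ_)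
open import Data.Fin using (Fin; zero; suc)
open import Data.Bool using (Bool; true; false; if_then_else_)
open import Data.Product using (Σ; ∃; _×_; _,_)
open import Data.Sum using (_⊎_; inj₁; inj₂)
open import Relation.Binary.PropositionalEquality using (_≡_)
open import Relation.Nullary using (¬_)

-- The real line, axiomatised as a complete ordered field (Agda's standard
-- library has no real numbers).  Every model is (classically) isomorphic to ℝ.
record RealLine : Set₁ where
  infixl 6 _+_ _-_
  infixl 7 _*_
  infix 4 _≤_ _<_
  field
    ℝ : Set
    0ℝ 1ℝ : ℝ
    _+_ _*_ : ℝ → ℝ → ℝ
    -_ : ℝ → ℝ
    _≤_ : ℝ → ℝ → Set
    +-assoc : ∀ x y z → (x + y) + z ≡ x + (y + z)
    +-comm : ∀ x y → x + y ≡ y + x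
    +-identityʳ : ∀ x → x + 0ℝ ≡ x
    +-inverseʳ : ∀ x → x + (- x) ≡ 0ℝ
    *-assoc : ∀ x y z → (x * y) * z ≡ x * (y * z)
    *-comm : ∀ x y → x * y ≡ y * x
    *-identityʳ : ∀ x → x * 1ℝ ≡ x
    distribˡ : ∀ x y z → x * (y + z) ≡ x * y + x * z
    0≢1 : ¬ (0ℝ ≡ 1ℝ)
    *-inverse : ∀ x → ¬ (x ≡ 0ℝ) → ∃ λ y → x * y ≡ 1ℝ
    ≤-refl : ∀ x → x ≤ x
    ≤-trans : ∀ {x y z} → x ≤ y → y ≤ z → x ≤ z
    ≤-antisym : ∀ {x y} → x ≤ y → y ≤ x → x ≡ y
    ≤-total : ∀ x y → x ≤ y ⊎ y ≤ x
    +-mono-≤ : ∀ {x y} z → x ≤ y → x + z ≤ y + z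
    *-nonneg : ∀ {x y} → 0ℝ ≤ x → 0ℝ ≤ y → 0ℝ ≤ x * y
    lub : (P : ℝ → Set) → (∃ λ x → P x) → (∃ λ u → ∀ x → P x → x ≤ u) →
          ∃ λ s → (∀ x → P x → x ≤ s) × (∀ u → (∀ x → P x → x ≤ u) → s ≤ u)

  _-_ : ℝ → ℝ → ℝ
  x - y = x + (- y)

  _<_ : ℝ → ℝ → Set
  x < y = (x ≤ y) × ¬ (x ≡ y)

  ∣_∣ : ℝ → ℝ
  ∣ x ∣ with ≤-total 0ℝ x
  ... | inj₁ _ = x
  ... | inj₂ _ = - x

  sumℝ : ∀ {n} → (Fin n → ℝ) → ℝ
  sumℝ {zero} f = 0ℝ
  sumℝ {suc n} f = f zero + sumℝ (λ i → f (suc i))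

count : ∀ {n} → (Fin n → Bool) → ℕ
count {zero} f = 0
count {suc n} f = (if f zero then 1 else 0) +ℕ count (λ i → f (suc i))

module OMMD (R : RealLine) where
  open RealLine R

  -- S = {s i | i : Fin m}, T = {t j | j : Fin n}; a set M ⊆ S × T of pairs
  -- is given by its indicator M i j.
  Matching : ℕ → ℕ → Set
  Matching m n = Fin m → Fin n → Bool

  IsOMMD : ∀ {m n} → (dS : Fin m → ℕ) → (dT : Fin n → ℕ) → Matching m n → Set
  IsOMMD {m} {n} dS dT M =
    (∀ i → dS i ≤ℕ count (λ j → M i j)) ×
    (∀ j → dT j ≤ℕ count (λ i → M i j))

  cost : ∀ {m n} → (s : Fin m → ℝ) → (t : Fin n → ℝ) → Matching m n → ℝ
  cost s t M = sumℝ (λ i → sumℝ (λ j → if M i j then ∣ s i - t j ∣ else 0ℝ))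

  IsMinOMMD : ∀ {m n} → (s : Fin m → ℝ) → (t : Fin n → ℝ) →
              (dS : Fin m → ℕ) → (dT : Fin n → ℕ) → Matching m n → Set
  IsMinOMMD s t dS dT M =
    IsOMMD dS dT M × (∀ M' → IsOMMD dS dT M' → cost s t M ≤ cost s t M')

module Submission where

-- Suppose (a , d) ∈ M while (a , b) ∉ M and (c , d) ∉ M.  Uncrossing M
-- removes the pair (a , d) and adds the pairs (a , b) and (c , d).  As
-- multisets of pairs, uncross M + {(a , d)} = M + {(a , b)} + {(c , d)}; this
-- one pointwise identity of indicator counts (uncross-ind) is the whole
-- combinatorial content of the proof.
--   * Summed along a row or a column it shows that no degree decreases (row a
--     and column d lose one pair and gain one), so uncrossing keeps an OMMD an
--     OMMD (uncross-row, uncross-col).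
--   * Summed with weights in an arbitrary commutative monoid it gives
--     cost (uncross M) + |a − d| = cost M + |a − b| + |c − d| (size-uncross).
-- Minimality of M therefore forces |a − d| ≤ |a − b| + |c − d|, which for
-- a ≤ b and c ≤ d reads d − a ≤ (b − a) + (d − c), i.e. c ≤ b
-- (dist-crossing), contradicting b < c.

open import Defs
open import Data.Nat using (ℕ; _≤_)
open import Data.Fin using (Fin)
open import Data.Bool using (true)
open import Data.Sum using (_⊎_)
open import Function.Definitions using (Injective)
open import Relation.Binary.PropositionalEquality using (_≡_)

open import Algebra.Bundles using (CommutativeMonoid)
open import Data.Bool using (Bool; false; if_then_else_; _∧_; _∨_; not)
open import Data.Bool.Properties using (∧-identityʳ; ∧-zeroʳ; T-≡; T-∧)
open import Data.Empty using (⊥; ⊥-elim)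
open import Data.Fin using (zero; suc)
open import Data.Fin.Properties using (_≟_)
import Data.Nat as ℕ
import Data.Nat.Properties as ℕP
open import Data.Product using (_×_; _,_; proj₁)
open import Data.Sum using (inj₁; inj₂)
open import Function.Bundles using (Equivalence)
open import Relation.Binary.PropositionalEquality
  using (_≢_; refl; sym; trans; cong; cong₂; subst; subst₂; module ≡-Reasoning)
open import Relation.Nullary using (does; yes; no)
open import Relation.Nullary.Negation using (contradiction)

ind : Bool → ℕ
ind b = if b then 1 else 0

-- Membership of one element after removing p and adding q and r, where x
-- is its membership before.
exchange : Bool → Bool → Bool → Bool → Bool
exchange x p q r = (x ∧ not p) ∨ (q ∨ r)

exchange-ind : ∀ x p q r →
               (p ≡ true → x ≡ true) → (q ≡ true → x ≡ false) →
               (r ≡ true → x ≡ false) → (q ≡ true → r ≡ true → ⊥) →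
               ind (exchange x p q r) ℕ.+ ind p ≡ ind x ℕ.+ (ind q ℕ.+ ind r)
exchange-ind false true  _     _     p⊆x _   _   _   = contradiction (p⊆x refl) λ ()
exchange-ind true  _     true  _     _   q∉x _   _   = contradiction (q∉x refl) λ ()
exchange-ind true  _     false true  _   _   r∉x _   = contradiction (r∉x refl) λ ()
exchange-ind false false true  true  _   _   _   q∩r = ⊥-elim (q∩r refl refl)
exchange-ind true  true  false false _   _   _   _   = refl
exchange-ind true  false false false _   _   _   _   = refl
exchange-ind false false true  false _   _   _   _   = refl
exchange-ind false false false true  _   _   _   _   = refl
exchange-ind false false false false _   _   _   _   = refl

single : ∀ {m n} → Fin m → Fin n → Fin m → Fin n → Bool
single x y i j = does (i ≟ x) ∧ does (j ≟ y)

does-sound : ∀ {n} (i x : Fin n) → does (i ≟ x) ≡ true → i ≡ x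
does-sound i x eq with i ≟ x
... | yes i≡x = i≡x
... | no _    = contradiction eq λ ()

single-sound : ∀ {m n} (x : Fin m) (y : Fin n) i j →
               single x y i j ≡ true → i ≡ x × j ≡ y
single-sound x y i j eq
  with i≟x , j≟y ← Equivalence.to T-∧ (Equivalence.from T-≡ eq) =
  does-sound i x (Equivalence.to T-≡ i≟x) , does-sound j y (Equivalence.to T-≡ j≟y)

uncross : ∀ {m n} → (Fin m → Fin n → Bool) →
          Fin m → Fin m → Fin n → Fin n → Fin m → Fin n → Bool
uncross M a c b d i j =
  exchange (M i j) (single a d i j) (single a b i j) (single c d i j)

record Crossing {m n} (M : Fin m → Fin n → Bool)
                (a c : Fin m) (b d : Fin n) : Set where
  field
    ad∈M : M a d ≡ true
    ab∉M : M a b ≡ false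
    cd∉M : M c d ≡ false
    a≢c  : a ≢ c

uncross-ind : ∀ {m n} {M : Fin m → Fin n → Bool} {a c b d} →
              Crossing M a c b d → ∀ i j →
              ind (uncross M a c b d i j) ℕ.+ ind (single a d i j) ≡
              ind (M i j) ℕ.+ (ind (single a b i j) ℕ.+ ind (single c d i j))
uncross-ind {M = M} {a} {c} {b} {d} cr i j =
  exchange-ind (M i j) _ _ _ ad⊆M ab∉M′ cd∉M′ disjoint
  where
  open Crossing cr
  ad⊆M : single a d i j ≡ true → M i j ≡ true
  ad⊆M h with refl , refl ← single-sound a d i j h = ad∈M
  ab∉M′ : single a b i j ≡ true → M i j ≡ false
  ab∉M′ h with refl , refl ← single-sound a b i j h = ab∉M
  cd∉M′ : single c d i j ≡ true → M i j ≡ false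
  cd∉M′ h with refl , refl ← single-sound c d i j h = cd∉M
  disjoint : single a b i j ≡ true → single c d i j ≡ true → ⊥
  disjoint h h′ = a≢c (trans (sym (proj₁ (single-sound a b i j h))) (proj₁ (single-sound c d i j h′)))

module WeightedSums {c ℓ} (C : CommutativeMonoid c ℓ) where
  open CommutativeMonoid C
    renaming (refl to ≈-refl; sym to ≈-sym; trans to ≈-trans; reflexive to ≈-reflexive)
  open import Algebra.Properties.CommutativeMonoid.Sum C
    using (sum; sum-cong-≋; sum-cong-≗; ∑-distrib-+; sum-replicate-zero) public
  open import Algebra.Properties.Monoid.Mult monoid
    using (×-homo-+) renaming (_×_ to _·_)
  open import Relation.Binary.Reasoning.Setoid setoid

  weight : Bool → Carrier → Carrier
  weight b w = if b then w else ε

  weight≈· : ∀ b w → weight b w ≈ ind b · w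
  weight≈· true  w = ≈-sym (identityʳ w)
  weight≈· false w = ≈-refl

  weight-exchange : ∀ {x′ p x q r} w →
                    ind x′ ℕ.+ ind p ≡ ind x ℕ.+ (ind q ℕ.+ ind r) →
                    weight x′ w ∙ weight p w ≈ weight x w ∙ (weight q w ∙ weight r w)
  weight-exchange {x′} {p} {x} {q} {r} w counts = begin
    weight x′ w ∙ weight p w             ≈⟨ ∙-cong (weight≈· x′ w) (weight≈· p w) ⟩
    ind x′ · w ∙ ind p · w               ≈⟨ ×-homo-+ w (ind x′) (ind p) ⟨
    (ind x′ ℕ.+ ind p) · w               ≡⟨ cong (_· w) counts ⟩
    (ind x ℕ.+ (ind q ℕ.+ ind r)) · w    ≈⟨ ×-homo-+ w (ind x) _ ⟩
    ind x · w ∙ (ind q ℕ.+ ind r) · w    ≈⟨ ∙-congˡ (×-homo-+ w (ind q) (ind r)) ⟩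
    ind x · w ∙ (ind q · w ∙ ind r · w)  ≈⟨ ∙-cong (weight≈· x w) (∙-cong (weight≈· q w) (weight≈· r w)) ⟨
    weight x w ∙ (weight q w ∙ weight r w) ∎

  sum-exchange : ∀ {n} {f p g q r : Fin n → Carrier} →
                 (∀ k → f k ∙ p k ≈ g k ∙ (q k ∙ r k)) →
                 sum f ∙ sum p ≈ sum g ∙ (sum q ∙ sum r)
  sum-exchange {f = f} {p} {g} {q} {r} pointwise = begin
    sum f ∙ sum p                  ≈⟨ ∑-distrib-+ f p ⟨
    sum (λ k → f k ∙ p k)          ≈⟨ sum-cong-≋ pointwise ⟩
    sum (λ k → g k ∙ (q k ∙ r k))  ≈⟨ ∑-distrib-+ g (λ k → q k ∙ r k) ⟩
    sum g ∙ sum (λ k → q k ∙ r k)  ≈⟨ ∙-congˡ (∑-distrib-+ q r) ⟩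
    sum g ∙ (sum q ∙ sum r)        ∎

  sum-point : ∀ {n} (x : Fin n) (f : Fin n → Carrier) →
              sum (λ k → weight (does (k ≟ x)) (f k)) ≈ f x
  sum-point {ℕ.suc n} zero f = begin
    f zero ∙ sum {n} (λ _ → ε)  ≈⟨ ∙-congˡ (sum-replicate-zero n) ⟩
    f zero ∙ ε                  ≈⟨ identityʳ (f zero) ⟩
    f zero                      ∎
  sum-point {ℕ.suc n} (suc x) f = begin
    ε ∙ sum (λ k → weight (does (k ≟ x)) (f (suc k)))  ≈⟨ identityˡ _ ⟩
    sum (λ k → weight (does (k ≟ x)) (f (suc k)))      ≈⟨ sum-point x (λ k → f (suc k)) ⟩
    f (suc x)                                          ∎

  sum-single-row : ∀ {m n} (x : Fin m) (y : Fin n) i (f : Fin n → Carrier) →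
                   sum (λ j → weight (single x y i j) (f j)) ≈ weight (does (i ≟ x)) (f y)
  sum-single-row {n = n} x y i f = along (does (i ≟ x))
    where
    along : ∀ b → sum (λ j → weight (b ∧ does (j ≟ y)) (f j)) ≈ weight b (f y)
    along true  = sum-point y f
    along false = sum-replicate-zero n

  sum-single-col : ∀ {m n} (x : Fin m) (y : Fin n) j (f : Fin m → Carrier) →
                   sum (λ i → weight (single x y i j) (f i)) ≈ weight (does (j ≟ y)) (f x)
  sum-single-col {m = m} x y j f = along (does (j ≟ y))
    where
    along : ∀ b → sum (λ i → weight (does (i ≟ x) ∧ b) (f i)) ≈ weight b (f x)
    along true  = ≈-trans (≈-reflexive (sum-cong-≗ λ i → cong (λ u → weight u (f i)) (∧-identityʳ _)))
                          (sum-point x f)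
    along false = ≈-trans (≈-reflexive (sum-cong-≗ λ i → cong (λ u → weight u (f i)) (∧-zeroʳ _)))
                          (sum-replicate-zero m)

  size : ∀ {m n} → (Fin m → Fin n → Carrier) → (Fin m → Fin n → Bool) → Carrier
  size w M = sum (λ i → sum (λ j → weight (M i j) (w i j)))

  size-single : ∀ {m n} (w : Fin m → Fin n → Carrier) x y → size w (single x y) ≈ w x y
  size-single w x y = begin
    size w (single x y)                        ≈⟨ sum-cong-≋ (λ i → sum-single-row x y i (w i)) ⟩
    sum (λ i → weight (does (i ≟ x)) (w i y))  ≈⟨ sum-point x (λ i → w i y) ⟩
    w x y                                      ∎

  size-uncross : ∀ {m n} {M : Fin m → Fin n → Bool} {a c b d} →
                 (w : Fin m → Fin n → Carrier) → Crossing M a c b d →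
                 size w (uncross M a c b d) ∙ w a d ≈ size w M ∙ (w a b ∙ w c d)
  size-uncross {M = M} {a} {c} {b} {d} w cr = begin
    size w (uncross M a c b d) ∙ w a d
      ≈⟨ ∙-congˡ (size-single w a d) ⟨
    size w (uncross M a c b d) ∙ size w (single a d)
      ≈⟨ sum-exchange (λ i → sum-exchange (λ j → weight-exchange (w i j) (uncross-ind cr i j))) ⟩
    size w M ∙ (size w (single a b) ∙ size w (single c d))
      ≈⟨ ∙-congˡ (∙-cong (size-single w a b) (size-single w c d)) ⟩
    size w M ∙ (w a b ∙ w c d) ∎

module ℕΣ = WeightedSums ℕP.+-0-commutativeMonoid

count-is-sum : ∀ {n} (f : Fin n → Bool) → count f ≡ ℕΣ.sum (λ k → ind (f k))
count-is-sum {ℕ.zero}  f = refl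
count-is-sum {ℕ.suc n} f = cong (ind (f zero) ℕ.+_) (count-is-sum (λ k → f (suc k)))

count-single-row : ∀ {m n} (x : Fin m) (y : Fin n) i → count (single x y i) ≡ ind (does (i ≟ x))
count-single-row x y i = trans (count-is-sum (single x y i)) (ℕΣ.sum-single-row x y i (λ _ → 1))

count-single-col : ∀ {m n} (x : Fin m) (y : Fin n) j →
                   count (λ i → single x y i j) ≡ ind (does (j ≟ y))
count-single-col x y j = trans (count-is-sum (λ i → single x y i j)) (ℕΣ.sum-single-col x y j (λ _ → 1))

≤-from-+ : ∀ x y u v → y ℕ.+ u ≡ x ℕ.+ (u ℕ.+ v) → x ≤ y
≤-from-+ x y u v eq = subst (x ≤_) x+v≡y (ℕP.m≤m+n x v)
  where
  open ≡-Reasoning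
  x+v≡y : x ℕ.+ v ≡ y
  x+v≡y = ℕP.+-cancelʳ-≡ u _ _ (begin
    (x ℕ.+ v) ℕ.+ u  ≡⟨ ℕP.+-assoc x v u ⟩
    x ℕ.+ (v ℕ.+ u)  ≡⟨ cong (x ℕ.+_) (ℕP.+-comm v u) ⟩
    x ℕ.+ (u ℕ.+ v)  ≡⟨ eq ⟨
    y ℕ.+ u          ∎)

count-exchange : ∀ {n} {f g p q r : Fin n → Bool} →
                 (∀ k → ind (g k) ℕ.+ ind (p k) ≡ ind (f k) ℕ.+ (ind (q k) ℕ.+ ind (r k))) →
                 count p ≡ count q → count f ≤ count g
count-exchange {f = f} {g} {p} {q} {r} pointwise p≡q =
  ≤-from-+ (count f) (count g) (count q) (count r)
    (subst (λ z → count g ℕ.+ z ≡ count f ℕ.+ (count q ℕ.+ count r)) p≡q summed)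
  where
  summed : count g ℕ.+ count p ≡ count f ℕ.+ (count q ℕ.+ count r)
  summed rewrite count-is-sum f | count-is-sum g | count-is-sum p
               | count-is-sum q | count-is-sum r = ℕΣ.sum-exchange pointwise

uncross-row : ∀ {m n} {M : Fin m → Fin n → Bool} {a c b d} → Crossing M a c b d →
              ∀ i → count (M i) ≤ count (uncross M a c b d i)
uncross-row {a = a} {c} {b} {d} cr i =
  count-exchange (uncross-ind cr i)
    (trans (count-single-row a d i) (sym (count-single-row a b i)))

uncross-col : ∀ {m n} {M : Fin m → Fin n → Bool} {a c b d} → Crossing M a c b d →
              ∀ j → count (λ i → M i j) ≤ count (λ i → uncross M a c b d i j)
uncross-col {M = M} {a} {c} {b} {d} cr j =
  count-exchange (λ i → trans (uncross-ind cr i j) (cong (ind (M i j) ℕ.+_)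
                                                            (ℕP.+-comm (ind (single a b i j)) (ind (single c d i j)))))
    (trans (count-single-col a d j) (sym (count-single-col c d j)))

module LineFacts (R : RealLine) where
  open RealLine R renaming (_≤_ to _≤ᵣ_)
  open ≡-Reasoning

  +-identityˡ : ∀ x → 0ℝ + x ≡ x
  +-identityˡ x = trans (+-comm 0ℝ x) (+-identityʳ x)

  +-commutativeMonoid : CommutativeMonoid _ _
  +-commutativeMonoid = record
    { Carrier = ℝ ; _≈_ = _≡_ ; _∙_ = _+_ ; ε = 0ℝ
    ; isCommutativeMonoid = record
      { isMonoid = record
        { isSemigroup = record
          { isMagma = record
            { isEquivalence = record { refl = refl ; sym = sym ; trans = trans }
            ; ∙-cong = cong₂ _+_ }
          ; assoc = +-assoc }
        ; identity = +-identityˡ , +-identityʳ }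
      ; comm = +-comm } }

  open import Algebra.Properties.CommutativeSemigroup
    (CommutativeMonoid.commutativeSemigroup +-commutativeMonoid) using (interchange)

  +-cancelʳ-≤ : ∀ {x y} z → x + z ≤ᵣ y + z → x ≤ᵣ y
  +-cancelʳ-≤ {x} {y} z le = subst₂ _≤ᵣ_ (undo x) (undo y) (+-mono-≤ (- z) le)
    where
    undo : ∀ v → (v + z) - z ≡ v
    undo v = trans (+-assoc v z (- z)) (trans (cong (v +_) (+-inverseʳ z)) (+-identityʳ v))

  +-cancelˡ-≤ : ∀ {x y} z → z + x ≤ᵣ z + y → x ≤ᵣ y
  +-cancelˡ-≤ {x} {y} z le = +-cancelʳ-≤ z (subst₂ _≤ᵣ_ (+-comm z x) (+-comm z y) le)

  minus-plus : ∀ x y → (y - x) + x ≡ y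
  minus-plus x y = begin
    (y + - x) + x  ≡⟨ +-assoc y (- x) x ⟩
    y + (- x + x)  ≡⟨ cong (y +_) (trans (+-comm (- x) x) (+-inverseʳ x)) ⟩
    y + 0ℝ         ≡⟨ +-identityʳ y ⟩
    y              ∎

  neg-unique : ∀ x z → x + z ≡ 0ℝ → z ≡ - x
  neg-unique x z sum≡0 = begin
    z              ≡⟨ minus-plus x z ⟨
    (z - x) + x    ≡⟨ cong (_+ x) (+-comm z (- x)) ⟩
    (- x + z) + x  ≡⟨ +-assoc (- x) z x ⟩
    - x + (z + x)  ≡⟨ cong (- x +_) (trans (+-comm z x) sum≡0) ⟩
    - x + 0ℝ       ≡⟨ +-identityʳ (- x) ⟩
    - x            ∎

  neg-minus : ∀ x y → - (x - y) ≡ y - x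
  neg-minus x y = sym (neg-unique (x - y) (y - x) (begin
    (x - y) + (y - x)  ≡⟨ +-assoc (x - y) y (- x) ⟨
    ((x - y) + y) - x  ≡⟨ cong (_- x) (minus-plus y x) ⟩
    x - x              ≡⟨ +-inverseʳ x ⟩
    0ℝ                 ∎))

  dist-of-≤ : ∀ {x y} → x ≤ᵣ y → ∣ x - y ∣ + x ≡ y
  dist-of-≤ {x} {y} x≤y with ≤-total 0ℝ (x - y)
  ... | inj₁ 0≤x-y = begin
    (x - y) + x  ≡⟨ cong (_+ x) x-y≡0 ⟩
    0ℝ + x       ≡⟨ +-identityˡ x ⟩
    x            ≡⟨ minus-plus y x ⟨
    (x - y) + y  ≡⟨ cong (_+ y) x-y≡0 ⟩
    0ℝ + y       ≡⟨ +-identityˡ y ⟩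
    y            ∎
    where
    x-y≡0 : x - y ≡ 0ℝ
    x-y≡0 = ≤-antisym (subst (x - y ≤ᵣ_) (+-inverseʳ y) (+-mono-≤ (- y) x≤y)) 0≤x-y
  ... | inj₂ _ = trans (cong (_+ x) (neg-minus x y)) (minus-plus x y)

  dist-crossing : ∀ {x y u v} → x ≤ᵣ y → u ≤ᵣ v → x ≤ᵣ v →
                  ∣ x - v ∣ ≤ᵣ ∣ x - y ∣ + ∣ u - v ∣ → u ≤ᵣ y
  dist-crossing {x} {y} {u} {v} x≤y u≤v x≤v shorter =
    +-cancelʳ-≤ v (subst₂ _≤ᵣ_ lhs rhs (+-mono-≤ (x + u) shorter))
    where
    lhs : ∣ x - v ∣ + (x + u) ≡ u + v
    lhs = begin
      ∣ x - v ∣ + (x + u)  ≡⟨ +-assoc ∣ x - v ∣ x u ⟨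
      (∣ x - v ∣ + x) + u  ≡⟨ cong (_+ u) (dist-of-≤ x≤v) ⟩
      v + u                ≡⟨ +-comm v u ⟩
      u + v                ∎
    rhs : (∣ x - y ∣ + ∣ u - v ∣) + (x + u) ≡ y + v
    rhs = begin
      (∣ x - y ∣ + ∣ u - v ∣) + (x + u)  ≡⟨ interchange ∣ x - y ∣ ∣ u - v ∣ x u ⟩
      (∣ x - y ∣ + x) + (∣ u - v ∣ + u)  ≡⟨ cong₂ _+_ (dist-of-≤ x≤y) (dist-of-≤ u≤v) ⟩
      y + v                              ∎

module Uncrossing (R : RealLine) where
  open RealLine R renaming (_≤_ to _≤ᵣ_)
  open OMMD R
  open LineFacts R
  module ℝΣ = WeightedSums +-commutativeMonoid

  sumℝ-is-sum : ∀ {n} (f : Fin n → ℝ) → sumℝ f ≡ ℝΣ.sum f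
  sumℝ-is-sum {ℕ.zero}  f = refl
  sumℝ-is-sum {ℕ.suc n} f = cong (f zero +_) (sumℝ-is-sum (λ k → f (suc k)))

  cost-is-size : ∀ {m n} (s : Fin m → ℝ) (t : Fin n → ℝ) M →
                 cost s t M ≡ ℝΣ.size (λ i j → ∣ s i - t j ∣) M
  cost-is-size {m} {n} s t M =
    trans (sumℝ-is-sum (λ i → sumℝ (term i))) (ℝΣ.sum-cong-≗ (λ i → sumℝ-is-sum (term i)))
    where
    term : Fin m → Fin n → ℝ
    term i j = ℝΣ.weight (M i j) ∣ s i - t j ∣

  uncross-feasible : ∀ {m n} {dS : Fin m → ℕ} {dT : Fin n → ℕ} {M a c b d} →
                     Crossing M a c b d → IsOMMD dS dT M → IsOMMD dS dT (uncross M a c b d)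
  uncross-feasible cr (rows , cols) =
    (λ i → ℕP.≤-trans (rows i) (uncross-row cr i)) ,
    (λ j → ℕP.≤-trans (cols j) (uncross-col cr j))

  uncross-bound : ∀ {m n} {s : Fin m → ℝ} {t : Fin n → ℝ} {dS dT M a c b d} →
                  Crossing M a c b d → IsMinOMMD s t dS dT M →
                  ∣ s a - t d ∣ ≤ᵣ ∣ s a - t b ∣ + ∣ s c - t d ∣
  uncross-bound {m} {n} {s = s} {t} {M = M} {a} {c} {b} {d} cr (feasible , minimal) =
    +-cancelˡ-≤ (cost s t M)
      (subst (cost s t M + ∣ s a - t d ∣ ≤ᵣ_) traded
        (+-mono-≤ ∣ s a - t d ∣ (minimal (uncross M a c b d) (uncross-feasible cr feasible))))
    where
    traded : cost s t (uncross M a c b d) + ∣ s a - t d ∣ ≡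
             cost s t M + (∣ s a - t b ∣ + ∣ s c - t d ∣)
    traded = begin
      cost s t (uncross M a c b d) + ∣ s a - t d ∣
        ≡⟨ cong (_+ ∣ s a - t d ∣) (cost-is-size s t _) ⟩
      ℝΣ.size w (uncross M a c b d) + ∣ s a - t d ∣
        ≡⟨ ℝΣ.size-uncross w cr ⟩
      ℝΣ.size w M + (∣ s a - t b ∣ + ∣ s c - t d ∣)
        ≡⟨ cong (_+ _) (cost-is-size s t M) ⟨
      cost s t M + (∣ s a - t b ∣ + ∣ s c - t d ∣) ∎
      where
      open ≡-Reasoning
      w : Fin m → Fin n → ℝ
      w i j = ∣ s i - t j ∣

lemma6 : (R : RealLine) → (m n : ℕ) →
    (s : Fin m → RealLine.ℝ R) → Injective _≡_ _≡_ s →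
    (t : Fin n → RealLine.ℝ R) → Injective _≡_ _≡_ t →
    (dS : Fin m → ℕ) → (∀ i → 1 ≤ dS i) →
    (dT : Fin n → ℕ) → (∀ j → 1 ≤ dT j) →
    (M : OMMD.Matching R m n) → OMMD.IsMinOMMD R s t dS dT M →
    (a c : Fin m) → (b d : Fin n) →
    RealLine._≤_ R (s a) (t b) → RealLine._<_ R (t b) (s c) →
    RealLine._≤_ R (s c) (t d) →
    M a d ≡ true → M a b ≡ true ⊎ M c d ≡ true
lemma6 R _ _ s _ t _ _ _ _ _ M minimal a c b d a≤b (b≤c , b≢c) c≤d ad∈M
  with M a b in ab | M c d in cd
... | true  | _    = inj₁ refl
... | false | true = inj₂ refl
... | false | false = ⊥-elim (b≢c (≤-antisym b≤c c≤b))
  where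
  open RealLine R renaming (_≤_ to _≤ᵣ_)
  open LineFacts R
  open Uncrossing R
  a≢c : a ≢ c
  a≢c refl = b≢c (≤-antisym b≤c a≤b)
  crossing : Crossing M a c b d
  crossing = record { ad∈M = ad∈M ; ab∉M = ab ; cd∉M = cd ; a≢c = a≢c }
  c≤b : s c ≤ᵣ t b
  c≤b = dist-crossing a≤b c≤d (≤-trans a≤b (≤-trans b≤c c≤d)) (uncross-bound crossing minimal)
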